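{- Let $n$ and $k$ be integers with $3\le k\le n-1$, and let $G$ be any unicyclic graph with $n$ vertices whose unique cycle has length $k$. Then $F(G)\ge F(L_{n,k})$, with equality if and only if $G\cong L_{n,k}$.
   Context: All graphs are finite and simple. The F-index of a graph $G$ is $F(G)=\sum_{v\in V(G)} d_G(v)^3$, where $d_G(v)$ denotes the degree of $v$. A unicyclic graph is a connected graph containing exactly one cycle. For $3\le k\le n-1$, the lollipop $L_{n,k}$ is the unicyclic graph of order $n$ obtained from vertex-disjoint copies of the cycle $C_k$ and the path $P_{n-k}$ (on $n-k$ vertices) by adding an edge joining a vertex of $C_k$ to an end vertex of $P_{n-k}$. -}

module Defs where

open import Data.Nat using (ℕ; zero; suc; s≤s; z≤n; _+_; _*_; _^_; _≤_; _<_; _≡ᵇ_)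
open import Data.Nat.Properties using ()
open import Data.Bool using (Bool; true; false; _∧_; _∨_; not; T)
open import Data.Fin using (Fin; toℕ)
open import Data.Fin.Properties using ()
open import Data.List using (List; []; _∷_; length; map; filter)
open import Data.Nat.ListAction using (sum)
open import Data.List.Base using (allFin)
open import Data.Product using (Σ; _×_; _,_; ∃)
open import Relation.Binary.PropositionalEquality using (_≡_; refl)
open import Relation.Nullary using (¬_)
open import Function.Bundles using (_↔_; Inverse)
open import Function.Definitions using (Injective)

record Graph (n : ℕ) : Set where
  field
    adj  : Fin n → Fin n → Bool
    adjSym : ∀ u v → adj u v ≡ adj v u
    adjIrr : ∀ v → adj v v ≡ false
open Graph public

countTrue : List Bool → ℕ
countTrue [] = 0
countTrue (true ∷ bs) = suc (countTrue bs)
countTrue (false ∷ bs) = countTrue bs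

deg : ∀ {n} → Graph n → Fin n → ℕ
deg {n} G v = countTrue (map (adj G v) (allFin n))

Findex : ∀ {n} → Graph n → ℕ
Findex {n} G = sum (map (λ v → deg G v ^ 3) (allFin n))

data Walk {n} (G : Graph n) : Fin n → Fin n → Set where
  here : ∀ {u} → Walk G u u
  step : ∀ {u w v} → T (adj G u w) → Walk G w v → Walk G u v

Connected : ∀ {n} → Graph n → Set
Connected G = ∀ u v → Walk G u v

nextMod : ∀ {k} → Fin k → Fin k
nextMod {suc k} i with Data.Fin.toℕ i Data.Nat.<? k
... | Relation.Nullary.yes p = Data.Fin.fromℕ< (Data.Nat.s≤s p)
... | Relation.Nullary.no _ = Data.Fin.zero
  where import Data.Fin

record Cycle {n} (G : Graph n) (k : ℕ) : Set where
  field
    len≥3 : 3 ≤ k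
    vtx   : Fin k → Fin n
    inj   : Injective _≡_ _≡_ vtx
    edges : ∀ i → T (adj G (vtx i) (vtx (nextMod i)))
open Cycle public

OnCycle : ∀ {n} {G : Graph n} {k} → Cycle G k → Fin n → Fin n → Set
OnCycle {k = k} C u v =
  Σ (Fin k) λ i → ((vtx C i ≡ u) × (vtx C (nextMod i) ≡ v))
                  Data.Sum.⊎ ((vtx C i ≡ v) × (vtx C (nextMod i) ≡ u))
  where import Data.Sum

SameCycle : ∀ {n} {G : Graph n} {k l} → Cycle G k → Cycle G l → Set
SameCycle {n} C D = ∀ (u v : Fin n) → (OnCycle C u v → OnCycle D u v) × (OnCycle D u v → OnCycle C u v)

Unicyclic : ∀ {n} → Graph n → Set
Unicyclic G =
  Connected G
  × Σ ℕ (λ k → Cycle G k)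
  × (∀ {k l} (C : Cycle G k) (D : Cycle G l) → SameCycle C D)

_≅_ : ∀ {n} → Graph n → Graph n → Set
_≅_ {n} G H = Σ (Fin n ↔ Fin n) λ f →
  ∀ u v → adj G u v ≡ adj H (Inverse.to f u) (Inverse.to f v)

-- Lollipop L_{n,k}: vertices 0..k-1 form the cycle (0,1,…,k-1,0),
-- vertices k..n-1 form a path k,k+1,…,n-1, and 0 is joined to k.
lolEdge : ℕ → ℕ → ℕ → Bool
lolEdge k a b =
  ((suc a ≡ᵇ b) ∧ not (b ≡ᵇ k))
  ∨ ((a ≡ᵇ 0) ∧ (suc b ≡ᵇ k))
  ∨ ((a ≡ᵇ 0) ∧ (b ≡ᵇ k))

lolAdj : (n k : ℕ) → Fin n → Fin n → Bool
lolAdj n k u v = lolEdge k (toℕ u) (toℕ v) ∨ lolEdge k (toℕ v) (toℕ u)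

private
  noSelf : ∀ a → (suc a ≡ᵇ a) ≡ false
  noSelf zero = refl
  noSelf (suc a) = noSelf a

  e : ∀ k → 3 ≤ k → ∀ a → lolEdge k a a ≡ false
  e (suc (suc (suc k))) h zero = refl
  e (suc zero) (s≤s ()) zero
  e (suc (suc zero)) (s≤s (s≤s ())) zero
  e k h (suc a) rewrite noSelf a = refl

lolIrrℕ : ∀ k → 3 ≤ k → ∀ a → (lolEdge k a a ∨ lolEdge k a a) ≡ false
lolIrrℕ k h a rewrite e k h a = refl

lolSym : ∀ n k (u v : Fin n) → lolAdj n k u v ≡ lolAdj n k v u
lolSym n k u v = Data.Bool.Properties.∨-comm (lolEdge k (toℕ u) (toℕ v)) (lolEdge k (toℕ v) (toℕ u))
  where import Data.Bool.Properties

Lollipop : (n k : ℕ) → 3 ≤ k → Graph n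
Lollipop n k h = record
  { adj = lolAdj n k
  ; adjSym = lolSym n k
  ; adjIrr = λ v → lolIrrℕ k h (toℕ v) }

-- For every d ∈ ℕ, d³ + 16 = 12 d + excess d with excess d ≥ 0, and excess d = 0 only for d = 2
-- (the line 12 d − 16 is the tangent of d³ at d = 2).  A connected graph containing a cycle has at
-- least n edges, so summing over the vertices gives F(G) ≥ 24 n − 16 n + Σ excess = 8 n + Σ excess.
-- As k < n, some cycle vertex (the root) also has a neighbour off the cycle, so its degree is at
-- least 3 and its excess at least 7; a leaf adds excess at least 5, and if there is no leaf then
-- all degrees are at least 2 and F(G) ≥ 8 (n − 1) + 27.  Either way F(G) ≥ 8 n + 12 = F(L_{n,k}).
-- If F(G) ≤ 8 n + 12 the excess budget forces degree 3 at the root, one leaf, and degree 2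
-- elsewhere.  Walking from the root away from the cycle then visits new vertices until it stops
-- at the leaf, and every vertex is on the cycle or on this walk; numbering both as in L_{n,k}
-- maps the edges of L_{n,k} to edges of G, and equal F-indices leave no room for further edges.

module Submission where

open import Data.Bool using (Bool; true; false; T; _∧_; not; if_then_else_)
import Data.Bool.Properties as Bool
open import Data.Empty using (⊥; ⊥-elim)
open import Data.Fin using (Fin; zero; suc; toℕ; fromℕ; fromℕ<; inject₁)
open import Data.Fin.Properties
  using (_≟_; any?; toℕ-injective; toℕ-fromℕ; toℕ-fromℕ<; toℕ-inject₁; toℕ<n; fromℕ<-toℕ; injective⇒≤)
import Data.Fin.Properties as Fin
open import Data.List using (List; []; _∷_; length; map; tabulate; filter)
open import Data.List.Membership.Propositional using (_∈_)
open import Data.List.Membership.Propositional.Properties using (∈-filter⁺)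
open import Data.List.Properties using (length-filter; filter-reject)
open import Data.List.Relation.Unary.All using (All; []; _∷_)
open import Data.List.Relation.Unary.All.Properties using (¬Any⇒All¬)
open import Data.List.Relation.Unary.Any using (here; there)
import Data.List.Relation.Unary.Any as Any
open import Data.List.Relation.Unary.Unique.Propositional using (Unique; []; _∷_)
open import Data.Nat using (ℕ; zero; suc; pred; _+_; _*_; _∸_; _^_; _≤_; _<_; _≥_; z≤n; s≤s; _≡ᵇ_; _<?_; _≤?_)
open import Data.Nat.ListAction using () renaming (sum to listSum)
open import Data.Nat.Properties hiding (_≟_)
import Data.Nat.Properties as ℕ
open import Algebra.Properties.Semiring.Sum ℕ.+-*-semiring
  using (sum; sum-cong-≗; ∑-distrib-+; *-distribˡ-sum; sum-permute; sum-init-last)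
open import Algebra.Properties.CommutativeSemigroup ℕ.+-commutativeSemigroup using (x∙yz≈y∙xz)
open import Data.Nat.Tactic.RingSolver using (solve-∀)
open import Data.Product using (Σ; ∃; _×_; _,_; proj₁; proj₂)
open import Data.Sum using (_⊎_; inj₁; inj₂)
open import Data.Unit using (tt)
open import Function using (_∘_; case_of_)
open import Function.Bundles using (_↔_; _⇔_; Equivalence; Inverse; mk⇔; mk↔ₛ′)
open import Function.Definitions using (Injective)
open import Function.Properties.Inverse using (↔-sym)
open import Relation.Binary.PropositionalEquality
open import Relation.Nullary using (¬_; Dec; yes; no; does)
open import Relation.Nullary.Decidable using (_×-dec_; ¬?)
open import Defs

-- Finite sums over Fin n

sum-const : ∀ n c → sum {n} (λ _ → c) ≡ n * c
sum-const zero    c = refl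
sum-const (suc n) c = cong (c +_) (sum-const n c)

sum-mono-≤ : ∀ {n} {f g : Fin n → ℕ} → (∀ i → f i ≤ g i) → sum f ≤ sum g
sum-mono-≤ {zero}  f≤g = z≤n
sum-mono-≤ {suc n} f≤g = +-mono-≤ (f≤g zero) (sum-mono-≤ (f≤g ∘ suc))

erase : ∀ {n} → Fin n → (Fin n → ℕ) → Fin n → ℕ
erase x f i = if does (i ≟ x) then 0 else f i

erase-≢ : ∀ {n} {x i : Fin n} (f : Fin n → ℕ) → i ≢ x → erase x f i ≡ f i
erase-≢ {x = x} {i} f i≢x with i ≟ x
... | yes i≡x = ⊥-elim (i≢x i≡x)
... | no  _   = refl

sum-erase : ∀ {n} (x : Fin n) (f : Fin n → ℕ) → sum f ≡ f x + sum (erase x f)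
sum-erase zero    f = cong (f zero +_) (sum-cong-≗ (λ i → sym (erase-≢ {x = zero} {suc i} f λ ())))
sum-erase (suc x) f = begin
  f zero + sum (f ∘ suc)                              ≡⟨ cong (f zero +_) (sum-erase x (f ∘ suc)) ⟩
  f zero + (f (suc x) + sum (erase x (f ∘ suc)))      ≡⟨ x∙yz≈y∙xz (f zero) (f (suc x)) _ ⟩
  f (suc x) + (f zero + sum (erase x (f ∘ suc)))      ≡⟨ cong (f (suc x) +_) (cong₂ _+_ erase-zero (sum-cong-≗ erase-suc)) ⟩
  f (suc x) + sum (erase (suc x) f)                   ∎
  where
  open ≡-Reasoning
  erase-zero : f zero ≡ erase (suc x) f zero
  erase-zero = sym (erase-≢ {x = suc x} f λ ())
  erase-suc : ∀ i → erase x (f ∘ suc) i ≡ erase (suc x) f (suc i)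
  erase-suc i with i ≟ x
  ... | yes refl = refl
  ... | no  _    = refl

sum-≥-distinct : ∀ {n} (f : Fin n → ℕ) {xs : List (Fin n)} → Unique xs → listSum (map f xs) ≤ sum f
sum-≥-distinct f []                     = z≤n
sum-≥-distinct f {x ∷ xs} (x∉xs ∷ uniq) = begin
  f x + listSum (map f xs)           ≡⟨ cong (f x +_) (cong listSum (map-erase x∉xs)) ⟩
  f x + listSum (map (erase x f) xs) ≤⟨ +-monoʳ-≤ (f x) (sum-≥-distinct (erase x f) uniq) ⟩
  f x + sum (erase x f)              ≡⟨ sum-erase x f ⟨
  sum f                              ∎
  where
  open ≤-Reasoning
  map-erase : ∀ {ys} → All (x ≢_) ys → map f ys ≡ map (erase x f) ys
  map-erase []             = refl
  map-erase (x≢y ∷ x∉ys) = cong₂ _∷_ (sym (erase-≢ f (x≢y ∘ sym))) (map-erase x∉ys)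

sum-≥-point : ∀ {n} (f : Fin n → ℕ) (x : Fin n) → f x ≤ sum f
sum-≥-point f x = subst (_≤ sum f) (+-identityʳ (f x)) (sum-≥-distinct f {x ∷ []} ([] ∷ []))

sum-gap : ∀ {n} {f g : Fin n → ℕ} → (∀ i → f i ≤ g i) → sum f + sum (λ i → g i ∸ f i) ≡ sum g
sum-gap {f = f} {g} f≤g = trans (sym (∑-distrib-+ f (λ i → g i ∸ f i))) (sum-cong-≗ (λ i → m+[n∸m]≡n (f≤g i)))

≤-gap : ∀ a {b c} → a + c ≤ b → c ≤ b ∸ a
≤-gap a {b} {c} a+c≤b = subst (_≤ b ∸ a) (m+n∸m≡n a c) (∸-monoˡ-≤ a a+c≤b)

m+1≤n⇒m<n : ∀ {m n} → m + 1 ≤ n → m < n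
m+1≤n⇒m<n {m} {n} = subst (_≤ n) (+-comm m 1)

m<n⇒m+1≤n : ∀ {m n} → m < n → m + 1 ≤ n
m<n⇒m+1≤n {m} {n} = subst (_≤ n) (+-comm 1 m)

m≤1+n⇒m≤n∨m≡1+n : ∀ {m n} → m ≤ suc n → m ≤ n ⊎ m ≡ suc n
m≤1+n⇒m≤n∨m≡1+n m≤1+n with m≤n⇒m<n∨m≡n m≤1+n
... | inj₁ m<1+n  = inj₁ (≤-pred m<1+n)
... | inj₂ m≡1+n  = inj₂ m≡1+n

sum-mono-≤-at : ∀ {n} {f g : Fin n → ℕ} (x : Fin n) {c} →
                (∀ i → f i ≤ g i) → f x + c ≤ g x → sum f + c ≤ sum g
sum-mono-≤-at {f = f} {g} x f≤g fx+c≤gx = subst (_ ≤_) (sum-gap f≤g)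
  (+-monoʳ-≤ (sum f) (≤-trans (≤-gap (f x) fx+c≤gx) (sum-≥-point (λ i → g i ∸ f i) x)))

sum-mono-≤-≡ : ∀ {n} {f g : Fin n → ℕ} → (∀ i → f i ≤ g i) → sum g ≤ sum f → ∀ i → f i ≡ g i
sum-mono-≤-≡ {f = f} {g} f≤g g≤f i = ≤-antisym (f≤g i) (≮⇒≥ λ fi<gi →
  <-irrefl refl (≤-trans (m+1≤n⇒m<n (sum-mono-≤-at i f≤g (m<n⇒m+1≤n fi<gi))) g≤f))

-- Degrees and neighbourhoods

indicator : Bool → ℕ
indicator true  = 1
indicator false = 0

indicator-≤-1 : ∀ b → indicator b ≤ 1
indicator-≤-1 true  = ≤-refl
indicator-≤-1 false = z≤n

T⇒1≤indicator : ∀ {b} → T b → 1 ≤ indicator b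
T⇒1≤indicator {true} _ = ≤-refl

countTrue-map-tabulate : ∀ {A : Set} n (p : A → Bool) (g : Fin n → A) →
                         countTrue (map p (tabulate g)) ≡ sum (indicator ∘ p ∘ g)
countTrue-map-tabulate zero    p g = refl
countTrue-map-tabulate (suc n) p g with p (g zero)
... | true  = cong suc (countTrue-map-tabulate n p (g ∘ suc))
... | false = countTrue-map-tabulate n p (g ∘ suc)

listSum-map-tabulate : ∀ {A : Set} n (h : A → ℕ) (g : Fin n → A) →
                       listSum (map h (tabulate g)) ≡ sum (h ∘ g)
listSum-map-tabulate zero    h g = refl
listSum-map-tabulate (suc n) h g = cong (h (g zero) +_) (listSum-map-tabulate n h (g ∘ suc))

sum-indicator-≤-length : ∀ {n} (p : Fin n → Bool) (cs : List ℕ) →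
                         (∀ u → T (p u) → toℕ u ∈ cs) → sum (indicator ∘ p) ≤ length cs
sum-indicator-≤-length {n} p [] p⊆[] = ≤-reflexive (trans (sum-cong-≗ off) (trans (sum-const n 0) (*-zeroʳ n)))
  where
  off : ∀ u → indicator (p u) ≡ 0
  off u with p u in eq
  ... | true  with () ← p⊆[] u (subst T (sym eq) tt)
  ... | false = refl
sum-indicator-≤-length {n} p (c ∷ cs) p⊆c∷cs = begin
  sum (indicator ∘ p)                          ≤⟨ sum-mono-≤ split ⟩
  sum (λ u → is-c u + indicator (p′ u))        ≡⟨ ∑-distrib-+ is-c (indicator ∘ p′) ⟩
  sum is-c + sum (indicator ∘ p′)              ≤⟨ +-mono-≤ (sum-indicator-≡ᵇ-≤-1 n c) (sum-indicator-≤-length p′ cs p′⊆cs) ⟩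
  suc (length cs)                              ∎
  where
  open ≤-Reasoning
  sum-indicator-≡ᵇ-≤-1 : ∀ n c → sum {n} (λ u → indicator (toℕ u ≡ᵇ c)) ≤ 1
  sum-indicator-≡ᵇ-≤-1 zero    c       = z≤n
  sum-indicator-≡ᵇ-≤-1 (suc n) zero    = s≤s (≤-reflexive (trans (sum-const n 0) (*-zeroʳ n)))
  sum-indicator-≡ᵇ-≤-1 (suc n) (suc c) = sum-indicator-≡ᵇ-≤-1 n c
  is-c : Fin n → ℕ
  is-c u = indicator (toℕ u ≡ᵇ c)
  p′ : Fin n → Bool
  p′ u = p u ∧ not (toℕ u ≡ᵇ c)
  split : ∀ u → indicator (p u) ≤ is-c u + indicator (p′ u)
  split u with p u | toℕ u ≡ᵇ c
  ... | true  | true  = ≤-refl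
  ... | true  | false = ≤-refl
  ... | false | _     = z≤n
  p′⊆cs : ∀ u → T (p′ u) → toℕ u ∈ cs
  p′⊆cs u p′u with p u | toℕ u ≡ᵇ c in eqc | p⊆c∷cs u
  ... | true | false | p⊆ with p⊆ tt
  ...   | here  refl  = ⊥-elim (subst T eqc (≡⇒≡ᵇ (toℕ u) (toℕ u) refl))
  ...   | there u∈cs  = u∈cs

module _ {n : ℕ} (G : Graph n) where

  Adj : Fin n → Fin n → Set
  Adj u v = T (adj G u v)

  adj-sym : ∀ {u v} → Adj u v → Adj v u
  adj-sym {u} {v} = subst T (adjSym G u v)

  adj⇒≢ : ∀ {u v} → Adj u v → u ≢ v
  adj⇒≢ {u} uv refl = subst T (adjIrr G u) uv

  deg≡sum : ∀ v → deg G v ≡ sum (indicator ∘ adj G v)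
  deg≡sum v = countTrue-map-tabulate n (adj G v) (λ i → i)

  Findex≡sum : Findex G ≡ sum (λ v → deg G v ^ 3)
  Findex≡sum = listSum-map-tabulate n (λ v → deg G v ^ 3) (λ i → i)

  length≤deg : ∀ v {us} → Unique us → All (Adj v) us → length us ≤ deg G v
  length≤deg v {us} uniq adjs = begin
    length us                                  ≤⟨ length≤listSum adjs ⟩
    listSum (map (indicator ∘ adj G v) us)     ≤⟨ sum-≥-distinct _ uniq ⟩
    sum (indicator ∘ adj G v)                  ≡⟨ deg≡sum v ⟨
    deg G v                                    ∎
    where
    open ≤-Reasoning
    length≤listSum : ∀ {ws} → All (Adj v) ws → length ws ≤ listSum (map (indicator ∘ adj G v) ws)
    length≤listSum []             = z≤n
    length≤listSum (vw ∷ adjs′) = +-mono-≤ (T⇒1≤indicator vw) (length≤listSum adjs′)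

  neighbours-⊆ : ∀ v {us} → deg G v ≤ length us → Unique us → All (Adj v) us →
                 ∀ {u} → Adj v u → u ∈ us
  neighbours-⊆ v {us} deg≤ uniq adjs {u} vu with Any.any? (u ≟_) us
  ... | yes u∈us = u∈us
  ... | no  u∉us = ⊥-elim (<⇒≱ (length≤deg v (¬Any⇒All¬ us u∉us ∷ uniq) (vu ∷ adjs)) deg≤)

  another-neighbour : ∀ v a → 2 ≤ deg G v → ∃ λ u → Adj v u × u ≢ a
  another-neighbour v a 2≤deg with any? (λ u → Bool.T? (adj G v u) ×-dec ¬? (u ≟ a))
  ... | yes found = found
  ... | no  none  = ⊥-elim (<⇒≱ 2≤deg (subst (_≤ 1) (sym (deg≡sum v)) (sum-indicator-≤-length _ (toℕ a ∷ []) only-a)))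
    where
    only-a : ∀ u → Adj v u → toℕ u ∈ toℕ a ∷ []
    only-a u vu with u ≟ a
    ... | yes refl = here refl
    ... | no  u≢a  = ⊥-elim (none (u , vu , u≢a))

  walk-crosses : ∀ (P : Fin n → Bool) {a b} → Walk G a b → P a ≡ false → P b ≡ true →
                 ∃ λ v → ∃ λ w → P v ≡ false × P w ≡ true × Adj v w
  walk-crosses P here          Pa≡false Pb≡true with () ← trans (sym Pa≡false) Pb≡true
  walk-crosses P {a} (step {w = w} aw walk) Pa≡false Pb≡true with P w in Pw
  ... | true  = a , w , Pa≡false , Pw , aw
  ... | false = walk-crosses P walk Pw Pb≡true

  walk-closed : ∀ (Q : Fin n → Set) → (∀ {v w} → Adj v w → Q w → Q v) →
                ∀ {a b} → Walk G a b → Q b → Q a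
  walk-closed Q closed here            Qb = Qb
  walk-closed Q closed (step aw walk) Qb = closed aw (walk-closed Q closed walk Qb)

-- A connected graph containing a cycle has at least as many edges as vertices

module _ {n : ℕ} (G : Graph n) where

  card : (Fin n → Bool) → ℕ
  card P = sum (indicator ∘ P)

  innerDegree : (Fin n → Bool) → Fin n → ℕ
  innerDegree P a = sum (λ b → indicator (P b ∧ adj G a b))

  innerDegreeSum : (Fin n → Bool) → ℕ
  innerDegreeSum P = sum (λ a → indicator (P a) * innerDegree P a)

  insert : Fin n → (Fin n → Bool) → Fin n → Bool
  insert v P a = if does (a ≟ v) then true else P a

  private
    insert-self : ∀ v P → insert v P v ≡ true
    insert-self v P with v ≟ v
    ... | yes _   = refl
    ... | no  v≢v = ⊥-elim (v≢v refl)

    insert-other : ∀ {v a} P → a ≢ v → insert v P a ≡ P a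
    insert-other {v} {a} P a≢v with a ≟ v
    ... | yes a≡v = ⊥-elim (a≢v a≡v)
    ... | no  _   = refl

    indicator-insert : ∀ v P a → indicator (P a) ≤ indicator (insert v P a)
    indicator-insert v P a with a ≟ v
    ... | yes _ = indicator-≤-1 (P a)
    ... | no  _ = ≤-refl

    indicator-∧-monoˡ : ∀ {p p′} q → indicator p ≤ indicator p′ → indicator (p ∧ q) ≤ indicator (p′ ∧ q)
    indicator-∧-monoˡ {true}  {true} q _ = ≤-refl
    indicator-∧-monoˡ {false}        q _ = z≤n

    insert-adj : ∀ v P a b → indicator (P b ∧ adj G a b) ≤ indicator (insert v P b ∧ adj G a b)
    insert-adj v P a b = indicator-∧-monoˡ (adj G a b) (indicator-insert v P b)

  card-insert : ∀ {v} P → P v ≡ false → card (insert v P) ≡ suc (card P)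
  card-insert {v} P Pv≡false = begin
    card (insert v P)                                   ≡⟨ sum-erase v _ ⟩
    indicator (insert v P v) + sum (erase v (indicator ∘ insert v P)) ≡⟨ cong₂ _+_ (cong indicator (insert-self v P)) (sum-cong-≗ same) ⟩
    1 + sum (erase v (indicator ∘ P))                   ≡⟨ cong (λ b → 1 + (indicator b + sum (erase v (indicator ∘ P)))) Pv≡false ⟨
    1 + (indicator (P v) + sum (erase v (indicator ∘ P))) ≡⟨ cong suc (sum-erase v _) ⟨
    suc (card P)                                        ∎
    where
    open ≡-Reasoning
    same : ∀ a → erase v (indicator ∘ insert v P) a ≡ erase v (indicator ∘ P) a
    same a with a ≟ v
    ... | yes _ = refl
    ... | no  _ = refl

  innerDegreeSum-insert : ∀ {v w} P → P v ≡ false → P w ≡ true → Adj G v w →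
                          innerDegreeSum P + 2 ≤ innerDegreeSum (insert v P)
  innerDegreeSum-insert {v} {w} P Pv≡false Pw≡true vw =
    subst (_ ≤_) (sum-gap f≤g) (+-monoʳ-≤ (sum f) (≤-trans gap-vw (sum-≥-distinct gap ((v≢w ∷ []) ∷ [] ∷ []))))
    where
    P′ : Fin n → Bool
    P′ = insert v P
    f g gap : Fin n → ℕ
    f a = indicator (P a) * innerDegree P a
    g a = indicator (P′ a) * innerDegree P′ a
    gap a = g a ∸ f a
    f≤g : ∀ a → f a ≤ g a
    f≤g a = *-mono-≤ (indicator-insert v P a) (sum-mono-≤ (insert-adj v P a))
    v≢w : v ≢ w
    v≢w = adj⇒≢ G vw
    P′w≡true : P′ w ≡ true
    P′w≡true = trans (insert-other P (v≢w ∘ sym)) Pw≡true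
    fv+1≤gv : f v + 1 ≤ g v
    fv+1≤gv = subst₂ (λ b b′ → indicator b * innerDegree P v + 1 ≤ indicator b′ * innerDegree P′ v)
                     (sym Pv≡false) (sym (insert-self v P))
                     (subst (1 ≤_) (sym (*-identityˡ _)) (≤-trans 1≤vw (sum-≥-point _ w)))
      where
      1≤vw : 1 ≤ indicator (P′ w ∧ adj G v w)
      1≤vw = subst (λ b → 1 ≤ indicator (b ∧ adj G v w)) (sym P′w≡true) (T⇒1≤indicator vw)
    fw+1≤gw : f w + 1 ≤ g w
    fw+1≤gw = subst₂ (λ b b′ → indicator b * innerDegree P w + 1 ≤ indicator b′ * innerDegree P′ w)
                     (sym Pw≡true) (sym P′w≡true)
                     (subst₂ (λ x y → x + 1 ≤ y) (sym (*-identityˡ _)) (sym (*-identityˡ _))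
                       (sum-mono-≤-at v (insert-adj v P w) 1+wv))
      where
      1+wv : indicator (P v ∧ adj G w v) + 1 ≤ indicator (P′ v ∧ adj G w v)
      1+wv = subst₂ (λ b b′ → indicator (b ∧ adj G w v) + 1 ≤ indicator (b′ ∧ adj G w v))
                    (sym Pv≡false) (sym (insert-self v P)) (T⇒1≤indicator (adj-sym G vw))
    gap-vw : 2 ≤ listSum (map gap (v ∷ w ∷ []))
    gap-vw = +-mono-≤ (≤-gap (f v) fv+1≤gv) (+-mono-≤ (≤-gap (f w) fw+1≤gw) z≤n)

  private
    insert-true : ∀ {v a} P → P a ≡ true → insert v P a ≡ true
    insert-true {v} {a} P Pa with a ≟ v
    ... | yes _ = refl
    ... | no  _ = Pa

    card-all : ∀ P → (∀ a → P a ≡ true) → card P ≡ n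
    card-all P all = trans (sum-cong-≗ (cong indicator ∘ all)) (trans (sum-const n 1) (*-identityʳ n))

    innerDegreeSum-all : ∀ P → (∀ a → P a ≡ true) → innerDegreeSum P ≡ sum (deg G)
    innerDegreeSum-all P all = sum-cong-≗ λ a → begin
      indicator (P a) * innerDegree P a ≡⟨ cong (λ b → indicator b * innerDegree P a) (all a) ⟩
      innerDegree P a + 0               ≡⟨ +-identityʳ _ ⟩
      innerDegree P a                   ≡⟨ sum-cong-≗ (λ b → cong (λ c → indicator (c ∧ adj G a b)) (all b)) ⟩
      sum (indicator ∘ adj G a)         ≡⟨ deg≡sum G a ⟨
      deg G a                           ∎
      where open ≡-Reasoning

    card-< : ∀ P {a} → P a ≡ false → card P < n
    card-< P {a} Pa≡false = m+1≤n⇒m<n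
      (subst (card P + 1 ≤_) (trans (sum-const n 1) (*-identityʳ n))
        (sum-mono-≤-at a (indicator-≤-1 ∘ P) (subst (λ b → indicator b + 1 ≤ 1) (sym Pa≡false) ≤-refl)))

  degree-sum-≥ : Connected G → ∀ P {r} → P r ≡ true → 2 * card P ≤ innerDegreeSum P → 2 * n ≤ sum (deg G)
  degree-sum-≥ conn P₀ {r} Pr 2card≤inner = grow n P₀ Pr 2card≤inner (m≤n+m n (card P₀))
    where
    grow : ∀ fuel P → P r ≡ true → 2 * card P ≤ innerDegreeSum P → n ≤ card P + fuel → 2 * n ≤ sum (deg G)
    grow fuel P Pr 2card≤inner n≤card+fuel with any? (λ a → P a Bool.≟ false)
    ... | no none = subst₂ (λ c s → 2 * c ≤ s) (card-all P all) (innerDegreeSum-all P all) 2card≤inner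
      where
      all : ∀ a → P a ≡ true
      all a = Bool.¬-not (λ Pa≡false → none (a , Pa≡false))
    ... | yes (a , Pa≡false) with fuel | walk-crosses G P (conn a r) Pa≡false Pr
    ...   | zero     | _ = ⊥-elim (<⇒≱ (card-< P Pa≡false) (subst (n ≤_) (+-identityʳ _) n≤card+fuel))
    ...   | suc fuel′ | v , w , Pv≡false , Pw≡true , vw =
      grow fuel′ (insert v P) (insert-true P Pr) 2card≤inner′ (subst (n ≤_) card+fuel≡ n≤card+fuel)
      where
      open ≤-Reasoning
      card+fuel≡ : card P + suc fuel′ ≡ card (insert v P) + fuel′
      card+fuel≡ = trans (+-suc (card P) fuel′) (cong (_+ fuel′) (sym (card-insert P Pv≡false)))
      2card≤inner′ : 2 * card (insert v P) ≤ innerDegreeSum (insert v P)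
      2card≤inner′ = begin
        2 * card (insert v P)    ≡⟨ cong (2 *_) (card-insert P Pv≡false) ⟩
        2 * suc (card P)         ≡⟨ trans (*-suc 2 (card P)) (+-comm 2 _) ⟩
        2 * card P + 2           ≤⟨ +-monoˡ-≤ 2 2card≤inner ⟩
        innerDegreeSum P + 2     ≤⟨ innerDegreeSum-insert P Pv≡false Pw≡true vw ⟩
        innerDegreeSum (insert v P) ∎

-- Cycles

toℕ-nextMod : ∀ {m} (i : Fin (suc m)) → toℕ i < m → toℕ (nextMod i) ≡ suc (toℕ i)
toℕ-nextMod {m} i i<m with toℕ i <? m
... | yes i<m′ = toℕ-fromℕ< (s≤s i<m′)
... | no  i≮m  = ⊥-elim (i≮m i<m)

nextMod-last : ∀ {m} (i : Fin (suc m)) → toℕ i ≡ m → nextMod i ≡ zero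
nextMod-last {m} i i≡m with toℕ i <? m
... | yes i<m = ⊥-elim (<-irrefl i≡m i<m)
... | no  _   = refl

toℕ<m⊎≡m : ∀ {m} (i : Fin (suc m)) → toℕ i < m ⊎ toℕ i ≡ m
toℕ<m⊎≡m i with m≤n⇒m<n∨m≡n (≤-pred (toℕ<n i))
... | inj₁ i<m = inj₁ i<m
... | inj₂ i≡m = inj₂ i≡m

prevMod : ∀ {m} → Fin (suc m) → Fin (suc m)
prevMod {m} zero = fromℕ m
prevMod (suc j)  = inject₁ j

nextMod-prevMod : ∀ {m} (i : Fin (suc m)) → nextMod (prevMod i) ≡ i
nextMod-prevMod {m} zero    = nextMod-last (fromℕ m) (toℕ-fromℕ m)
nextMod-prevMod {suc m} (suc j) = toℕ-injective (begin
  toℕ (nextMod (inject₁ j)) ≡⟨ toℕ-nextMod (inject₁ j) (subst (_< suc m) (sym (toℕ-inject₁ j)) (toℕ<n j)) ⟩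
  suc (toℕ (inject₁ j))     ≡⟨ cong suc (toℕ-inject₁ j) ⟩
  suc (toℕ j)               ∎)
  where open ≡-Reasoning

nextMod-injective : ∀ {m} → Injective _≡_ _≡_ (nextMod {suc m})
nextMod-injective {m} {i} {j} eq with toℕ<m⊎≡m i | toℕ<m⊎≡m j
... | inj₁ i<m | inj₁ j<m = toℕ-injective (suc-injective
      (trans (sym (toℕ-nextMod i i<m)) (trans (cong toℕ eq) (toℕ-nextMod j j<m))))
... | inj₂ i≡m | inj₂ j≡m = toℕ-injective (trans i≡m (sym j≡m))
... | inj₁ i<m | inj₂ j≡m with () ← trans (sym (toℕ-nextMod i i<m)) (cong toℕ (trans eq (nextMod-last j j≡m)))
... | inj₂ i≡m | inj₁ j<m with () ← trans (sym (toℕ-nextMod j j<m)) (cong toℕ (trans (sym eq) (nextMod-last i i≡m)))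

nextMod≢prevMod : ∀ {m} → 2 ≤ m → (i : Fin (suc m)) → nextMod i ≢ prevMod i
nextMod≢prevMod {m} 2≤m zero next≡prev with toℕ<m⊎≡m {m} zero
... | inj₁ 0<m = <-irrefl (trans (sym (toℕ-nextMod zero 0<m)) (trans (cong toℕ next≡prev) (toℕ-fromℕ m))) 2≤m
... | inj₂ 0≡m = <-irrefl 0≡m (≤-trans (s≤s z≤n) 2≤m)
nextMod≢prevMod {suc m} 2≤m (suc j) next≡prev with toℕ<m⊎≡m (suc j)
... | inj₁ j+1<m = <-irrefl (trans (sym (toℕ-inject₁ j)) (trans (cong toℕ (sym next≡prev)) (toℕ-nextMod (suc j) j+1<m)))
                           (m<n⇒m<1+n (n<1+n (toℕ j)))
... | inj₂ j+1≡m = <-irrefl (trans (sym j≡0) (suc-injective j+1≡m)) (≤-pred 2≤m)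
  where
  j≡0 : toℕ j ≡ 0
  j≡0 = trans (sym (toℕ-inject₁ j)) (cong toℕ (trans (sym next≡prev) (nextMod-last (suc j) j+1≡m)))

nextMod^ : ∀ {m} → ℕ → Fin (suc m) → Fin (suc m)
nextMod^ zero    i = i
nextMod^ (suc t) i = nextMod (nextMod^ t i)

nextMod^-injective : ∀ {m} t → Injective _≡_ _≡_ (nextMod^ {m} t)
nextMod^-injective zero    eq = eq
nextMod^-injective (suc t) eq = nextMod^-injective t (nextMod-injective eq)

toℕ-nextMod^-zero : ∀ {m} t → t ≤ m → toℕ (nextMod^ {m} t zero) ≡ t
toℕ-nextMod^-zero zero    _   = refl
toℕ-nextMod^-zero (suc t) t<m = trans (toℕ-nextMod _ (subst (_< _) (sym ih) t<m)) (cong suc ih)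
  where
  ih : toℕ (nextMod^ t zero) ≡ t
  ih = toℕ-nextMod^-zero t (<⇒≤ t<m)

nextMod^-nextMod : ∀ {m} t (i : Fin (suc m)) → nextMod^ t (nextMod i) ≡ nextMod (nextMod^ t i)
nextMod^-nextMod zero    i = refl
nextMod^-nextMod (suc t) i = cong nextMod (nextMod^-nextMod t i)

module _ {n : ℕ} {G : Graph n} where

  CycleVertex : ∀ {k} → Cycle G k → Fin n → Set
  CycleVertex {k} C u = ∃ λ (i : Fin k) → vtx C i ≡ u

  cycleVertex? : ∀ {k} (C : Cycle G k) u → Dec (CycleVertex C u)
  cycleVertex? C u = any? (λ i → vtx C i ≟ u)

  rotate : ∀ {m} (C : Cycle G (suc m)) (j : Fin (suc m)) →
           Σ (Cycle G (suc m)) λ C′ → vtx C′ zero ≡ vtx C j × (∀ {u} → CycleVertex C′ u → CycleVertex C u)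
  rotate {m} C j = C′ , cong (vtx C) (toℕ-injective (toℕ-nextMod^-zero (toℕ j) (≤-pred (toℕ<n j))))
                     , λ (i , eq) → shift i , eq
    where
    shift : Fin (suc m) → Fin (suc m)
    shift = nextMod^ (toℕ j)
    C′ : Cycle G (suc m)
    C′ = record
      { len≥3 = len≥3 C
      ; vtx   = vtx C ∘ shift
      ; inj   = nextMod^-injective (toℕ j) ∘ inj C
      ; edges = λ i → subst (λ i′ → T (adj G (vtx C (shift i)) (vtx C i′))) (sym (nextMod^-nextMod (toℕ j) i)) (edges C (shift i))
      }

  cycle-neighbours : ∀ {m} (C : Cycle G (suc m)) i →
                     Unique (vtx C (nextMod i) ∷ vtx C (prevMod i) ∷ []) × All (Adj G (vtx C i)) (vtx C (nextMod i) ∷ vtx C (prevMod i) ∷ [])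
  cycle-neighbours {m} C i =
    ((nextMod≢prevMod (≤-pred (len≥3 C)) i ∘ inj C) ∷ []) ∷ [] ∷ [] ,
    edges C i ∷ adj-sym G (subst (λ i′ → T (adj G (vtx C (prevMod i)) (vtx C i′))) (nextMod-prevMod i) (edges C (prevMod i))) ∷ []

  off-cycle-vertex : ∀ {k} (C : Cycle G k) → k < n → ∃ λ u → ¬ CycleVertex C u
  off-cycle-vertex {k} C k<n with any? (λ u → ¬? (cycleVertex? C u))
  ... | yes found = found
  ... | no  none  = ⊥-elim (<⇒≱ k<n (injective⇒≤ {f = index} index-injective))
    where
    on-cycle : ∀ u → CycleVertex C u
    on-cycle u with cycleVertex? C u
    ... | yes on  = on
    ... | no  off = ⊥-elim (none (u , off))
    index : Fin n → Fin k
    index = proj₁ ∘ on-cycle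
    index-injective : Injective _≡_ _≡_ index
    index-injective {u} {v} eq = trans (sym (proj₂ (on-cycle u))) (trans (cong (vtx C) eq) (proj₂ (on-cycle v)))

  cycleSet : ∀ {k} → Cycle G k → Fin n → Bool
  cycleSet C u = does (cycleVertex? C u)

  cycleSet-vtx : ∀ {k} (C : Cycle G k) i → cycleSet C (vtx C i) ≡ true
  cycleSet-vtx C i with cycleVertex? C (vtx C i)
  ... | yes _   = refl
  ... | no  off = ⊥-elim (off (i , refl))

  cycleSet-on : ∀ {k} {C : Cycle G k} {u} → CycleVertex C u → cycleSet C u ≡ true
  cycleSet-on {C = C} (i , refl) = cycleSet-vtx C i

  cycleSet-off : ∀ {k} {C : Cycle G k} {u} → ¬ CycleVertex C u → cycleSet C u ≡ false
  cycleSet-off {C = C} {u} off with cycleVertex? C u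
  ... | yes on = ⊥-elim (off on)
  ... | no  _  = refl

  degree-sum-≥-2n : ∀ {m} → Connected G → Cycle G (suc m) → 2 * n ≤ sum (deg G)
  degree-sum-≥-2n G-conn C = degree-sum-≥ G G-conn (cycleSet C) (cycleSet-vtx C zero) 2card≤inner
    where
    P : Fin n → Bool
    P = cycleSet C
    pointwise : ∀ a → 2 * indicator (P a) ≤ indicator (P a) * innerDegree G P a
    pointwise a with cycleVertex? C a
    ... | no  off      = subst (λ b → 2 * indicator b ≤ indicator b * innerDegree G P a) (sym (cycleSet-off {C = C} off)) z≤n
    ... | yes (i , refl) = subst (λ b → 2 * indicator b ≤ indicator b * innerDegree G P (vtx C i)) (sym (cycleSet-vtx C i))
                             (subst (2 ≤_) (sym (+-identityʳ _)) (≤-trans 2≤nbrs (sum-≥-distinct _ (proj₁ (cycle-neighbours C i)))))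
      where
      inner : ∀ j → Adj G (vtx C i) (vtx C j) → 1 ≤ indicator (P (vtx C j) ∧ adj G (vtx C i) (vtx C j))
      inner j ij = subst (λ b → 1 ≤ indicator (b ∧ adj G (vtx C i) (vtx C j))) (sym (cycleSet-vtx C j)) (T⇒1≤indicator ij)
      2≤nbrs : 2 ≤ listSum (map (λ b → indicator (P b ∧ adj G (vtx C i) b)) (vtx C (nextMod i) ∷ vtx C (prevMod i) ∷ []))
      2≤nbrs with cycle-neighbours C i
      ... | _ , i-next ∷ i-prev ∷ [] = +-mono-≤ (inner (nextMod i) i-next) (+-mono-≤ (inner (prevMod i) i-prev) z≤n)
    2card≤inner : 2 * card G P ≤ innerDegreeSum G P
    2card≤inner = subst (_≤ innerDegreeSum G P) (sym (*-distribˡ-sum 2 (indicator ∘ P))) (sum-mono-≤ pointwise)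

-- The estimate d³ + 16 ≥ 12 d

excess : ℕ → ℕ
excess d = d ^ 3 + 16 ∸ 12 * d

private
  16d≤d³ : ∀ d → 4 ≤ d → 16 * d ≤ d ^ 3
  16d≤d³ d 4≤d = begin
    16 * d          ≡⟨ *-assoc 4 4 d ⟩
    4 * (4 * d)     ≤⟨ *-mono-≤ 4≤d (*-monoˡ-≤ d 4≤d) ⟩
    d * (d * d)     ≡⟨ cong (λ x → d * (d * x)) (*-identityʳ d) ⟨
    d ^ 3           ∎
    where open ≤-Reasoning

  12d+16≤d³ : ∀ d → 4 ≤ d → 12 * d + 16 ≤ d ^ 3
  12d+16≤d³ d 4≤d = begin
    12 * d + 16     ≤⟨ +-monoʳ-≤ (12 * d) (*-monoʳ-≤ 4 4≤d) ⟩
    12 * d + 4 * d  ≡⟨ *-distribʳ-+ d 12 4 ⟨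
    16 * d          ≤⟨ 16d≤d³ d 4≤d ⟩
    d ^ 3           ∎
    where open ≤-Reasoning

  4≤4+ : ∀ d → 4 ≤ suc (suc (suc (suc d)))
  4≤4+ d = s≤s (s≤s (s≤s (s≤s z≤n)))

12d≤d³+16 : ∀ d → 12 * d ≤ d ^ 3 + 16
12d≤d³+16 0 = z≤n
12d≤d³+16 1 = ≤ᵇ⇒≤ 12 17 tt
12d≤d³+16 2 = ≤ᵇ⇒≤ 24 24 tt
12d≤d³+16 3 = ≤ᵇ⇒≤ 36 43 tt
12d≤d³+16 d@(suc (suc (suc (suc e)))) = ≤-trans (m≤m+n (12 * d) 16) (≤-trans (12d+16≤d³ d (4≤4+ e)) (m≤m+n (d ^ 3) 16))

cube+16≡12d+excess : ∀ d → d ^ 3 + 16 ≡ 12 * d + excess d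
cube+16≡12d+excess d = sym (m+[n∸m]≡n (12d≤d³+16 d))

excess-≥-16 : ∀ d → 4 ≤ d → 16 ≤ excess d
excess-≥-16 d 4≤d = ≤-gap (12 * d) (≤-trans (12d+16≤d³ d 4≤d) (m≤m+n (d ^ 3) 16))

excess-≥-8 : ∀ d → 4 ≤ d → 8 ≤ excess d
excess-≥-8 d 4≤d = ≤-trans (≤ᵇ⇒≤ 8 16 tt) (excess-≥-16 d 4≤d)

excess-≥-7 : ∀ d → 3 ≤ d → 7 ≤ excess d
excess-≥-7 1                         (s≤s ())
excess-≥-7 2                         (s≤s (s≤s ()))
excess-≥-7 3                         _ = ≤-refl
excess-≥-7 d@(suc (suc (suc (suc e)))) _ = ≤-trans (≤ᵇ⇒≤ 7 8 tt) (excess-≥-8 d (4≤4+ e))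

excess-≥-5 : ∀ d → d ≤ 1 → 5 ≤ excess d
excess-≥-5 0 _ = ≤ᵇ⇒≤ 5 16 tt
excess-≥-5 1 _ = ≤-refl
excess-≥-5 (suc (suc _)) (s≤s ())

excess-≥-1 : ∀ d → d ≢ 2 → 1 ≤ excess d
excess-≥-1 0                   _   = s≤s z≤n
excess-≥-1 1                   _   = s≤s z≤n
excess-≥-1 2                   2≢2 = ⊥-elim (2≢2 refl)
excess-≥-1 d@(suc (suc (suc _))) _ = ≤-trans (s≤s z≤n) (excess-≥-7 d (s≤s (s≤s (s≤s z≤n))))

cube-sum-≥ : ∀ {n} (d : Fin n → ℕ) → 2 * n ≤ sum d → 8 * n + sum (excess ∘ d) ≤ sum (λ v → d v ^ 3)
cube-sum-≥ {n} d 2n≤sum = +-cancelʳ-≤ (n * 16) _ _ (begin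
  8 * n + sum (excess ∘ d) + n * 16          ≡⟨ solve-rearrange n (sum (excess ∘ d)) ⟩
  12 * (2 * n) + sum (excess ∘ d)            ≤⟨ +-monoˡ-≤ (sum (excess ∘ d)) (*-monoʳ-≤ 12 2n≤sum) ⟩
  12 * sum d + sum (excess ∘ d)              ≡⟨ cong (_+ sum (excess ∘ d)) (*-distribˡ-sum 12 d) ⟩
  sum (λ v → 12 * d v) + sum (excess ∘ d)    ≡⟨ ∑-distrib-+ (λ v → 12 * d v) (excess ∘ d) ⟨
  sum (λ v → 12 * d v + excess (d v))        ≡⟨ sum-cong-≗ (λ v → cube+16≡12d+excess (d v)) ⟨
  sum (λ v → d v ^ 3 + 16)                   ≡⟨ ∑-distrib-+ (λ v → d v ^ 3) (λ _ → 16) ⟩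
  sum (λ v → d v ^ 3) + sum {n} (λ _ → 16)   ≡⟨ cong (sum (λ v → d v ^ 3) +_) (sum-const n 16) ⟩
  sum (λ v → d v ^ 3) + n * 16               ∎)
  where
  open ≤-Reasoning
  solve-rearrange : ∀ n e → 8 * n + e + n * 16 ≡ 12 * (2 * n) + e
  solve-rearrange = solve-∀

cube-sum-≥-no-leaf : ∀ {n} (d : Fin n → ℕ) x → (∀ v → 2 ≤ d v) → 3 ≤ d x → 8 * n + 19 ≤ sum (λ v → d v ^ 3)
cube-sum-≥-no-leaf {n} d x 2≤d 3≤dx = subst (λ s → s + 19 ≤ sum (λ v → d v ^ 3)) (trans (sum-const n 8) (*-comm n 8))
  (sum-mono-≤-at {f = λ _ → 8} x (λ v → ^-monoˡ-≤ 3 (2≤d v)) (^-monoˡ-≤ 3 3≤dx))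

-- The lower bound

record CycleWithStick {n} (G : Graph n) (m : ℕ) : Set where
  field
    cycle     : Cycle G (suc m)
    stick     : Fin n
    stick-off : ¬ CycleVertex cycle stick
    root-stick : Adj G (vtx cycle zero) stick

cycle-with-stick : ∀ {n} {G : Graph n} {m} → Connected G → Cycle G (suc m) → suc m < n → CycleWithStick G m
cycle-with-stick {G = G} G-conn C k<n with off-cycle-vertex C k<n
... | u , u-off with walk-crosses G (cycleSet C) (G-conn u (vtx C zero)) (cycleSet-off {C = C} u-off) (cycleSet-vtx C zero)
... | w , c , w∉C , c∈C , wc with cycleVertex? C c
... | no  c-off with () ← trans (sym c∈C) (cycleSet-off {C = C} c-off)
... | yes (j , refl) with rotate C j
... | C′ , root≡ , C′⊆C = record
  { cycle      = C′
  ; stick      = w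
  ; stick-off  = λ on → case trans (sym (cycleSet-on {C = C} (C′⊆C on))) w∉C of λ ()
  ; root-stick = subst (λ r → Adj G r w) (sym root≡) (adj-sym G wc)
  }

module LowerBound {n} {G : Graph n} (G-conn : Connected G) {m} (S : CycleWithStick G m) where
  open CycleWithStick S public

  root : Fin n
  root = vtx cycle zero

  d : Fin n → ℕ
  d = deg G

  cycle≢stick : ∀ i → vtx cycle i ≢ stick
  cycle≢stick i eq = stick-off (i , eq)

  root-neighbours : List (Fin n)
  root-neighbours = vtx cycle (nextMod zero) ∷ vtx cycle (prevMod zero) ∷ stick ∷ []

  root-neighbours-unique : Unique root-neighbours
  root-neighbours-unique with cycle-neighbours cycle zero
  ... | (next≢prev ∷ []) ∷ _ , _ =
    (next≢prev ∷ cycle≢stick (nextMod zero) ∷ []) ∷ (cycle≢stick (prevMod zero) ∷ []) ∷ [] ∷ []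

  root-neighbours-adj : All (Adj G root) root-neighbours
  root-neighbours-adj with cycle-neighbours cycle zero
  ... | _ , root-next ∷ root-prev ∷ [] = root-next ∷ root-prev ∷ root-stick ∷ []

  3≤d-root : 3 ≤ d root
  3≤d-root = length≤deg G root root-neighbours-unique root-neighbours-adj

  8n+excess≤Findex : 8 * n + sum (excess ∘ d) ≤ Findex G
  8n+excess≤Findex = ≤-trans (cube-sum-≥ d (degree-sum-≥-2n G-conn cycle)) (≤-reflexive (sym (Findex≡sum G)))

  root≢leaf : ∀ {ℓ} → d ℓ ≤ 1 → root ≢ ℓ
  root≢leaf dℓ≤1 refl = <⇒≱ (≤-trans (s≤s (s≤s z≤n)) 3≤d-root) dℓ≤1

  excess-≥-at : ∀ {vs} → Unique vs → listSum (map (excess ∘ d) vs) ≤ sum (excess ∘ d)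
  excess-≥-at = sum-≥-distinct (excess ∘ d)

  Findex-≥-no-leaf : (∀ v → 2 ≤ d v) → 8 * n + 19 ≤ Findex G
  Findex-≥-no-leaf 2≤d = ≤-trans (cube-sum-≥-no-leaf d root 2≤d 3≤d-root) (≤-reflexive (sym (Findex≡sum G)))

  Findex-≥ : 8 * n + 12 ≤ Findex G
  Findex-≥ with any? (λ v → d v ≤? 1)
  ... | yes (ℓ , dℓ≤1) =
    ≤-trans (+-monoʳ-≤ (8 * n) (≤-trans 12≤ (excess-≥-at ((root≢leaf dℓ≤1 ∷ []) ∷ [] ∷ [])))) 8n+excess≤Findex
    where
    12≤ : 12 ≤ excess (d root) + (excess (d ℓ) + 0)
    12≤ = +-mono-≤ (excess-≥-7 (d root) 3≤d-root) (+-mono-≤ (excess-≥-5 (d ℓ) dℓ≤1) z≤n)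
  ... | no  no-leaf    = ≤-trans (+-monoʳ-≤ (8 * n) (≤ᵇ⇒≤ 12 19 tt)) (Findex-≥-no-leaf (λ v → ≰⇒> (no-leaf ∘ (v ,_))))

-- The lollipop L_{n,k}

data LolArc : ℕ → ℕ → ℕ → Set where
  path  : ∀ {k a} → suc a ≢ k → LolArc k a (suc a)
  close : ∀ {j} → LolArc (suc j) 0 j
  stem  : ∀ {k} → LolArc k 0 k

lolEdge⇒LolArc : ∀ k a b → T (lolEdge k a b) → LolArc k a b
lolEdge⇒LolArc k a b e with Equivalence.to Bool.T-∨ e
... | inj₁ e₁ with Equivalence.to Bool.T-∧ e₁
...   | a+1≡ᵇb , b≢ᵇk with ≡ᵇ⇒≡ (suc a) b a+1≡ᵇb
...     | refl = path λ a+1≡k → subst T (Equivalence.to Bool.T-not-≡ b≢ᵇk) (≡⇒≡ᵇ (suc a) k a+1≡k)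
lolEdge⇒LolArc k a b e | inj₂ e₂ with Equivalence.to Bool.T-∨ e₂
... | inj₁ e₃ with Equivalence.to Bool.T-∧ e₃
...   | a≡ᵇ0 , b+1≡ᵇk with ≡ᵇ⇒≡ a 0 a≡ᵇ0 | ≡ᵇ⇒≡ (suc b) k b+1≡ᵇk
...     | refl | refl = close
lolEdge⇒LolArc k a b e | inj₂ e₂ | inj₂ e₄ with Equivalence.to Bool.T-∧ e₄
...   | a≡ᵇ0 , b≡ᵇk with ≡ᵇ⇒≡ a 0 a≡ᵇ0 | ≡ᵇ⇒≡ b k b≡ᵇk
...     | refl | refl = stem

lolAdj⇒LolArc : ∀ n k (u v : Fin n) → T (lolAdj n k u v) → LolArc k (toℕ u) (toℕ v) ⊎ LolArc k (toℕ v) (toℕ u)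
lolAdj⇒LolArc n k u v e with Equivalence.to Bool.T-∨ e
... | inj₁ uv = inj₁ (lolEdge⇒LolArc k _ _ uv)
... | inj₂ vu = inj₂ (lolEdge⇒LolArc k _ _ vu)

-- The neighbours of a in L_{n,k} with the path continued forever; filter (_<? n) cuts it at n − 1.
lolNbrs : ℕ → ℕ → List ℕ
lolNbrs k zero    = 1 ∷ pred k ∷ k ∷ []
lolNbrs k (suc a) with suc (suc a) ℕ.≟ k | suc a ℕ.≟ k
... | yes _ | _     = a ∷ 0 ∷ []
... | no  _ | yes _ = suc (suc a) ∷ 0 ∷ []
... | no  _ | no  _ = suc (suc a) ∷ a ∷ []

LolArc⇒∈lolNbrs : ∀ {k a b} → 3 ≤ k → LolArc k a b ⊎ LolArc k b a → b ∈ lolNbrs k a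
LolArc⇒∈lolNbrs _ (inj₁ (path {a = zero} _)) = here refl
LolArc⇒∈lolNbrs {k} _ (inj₁ (path {a = suc a} a+2≢k)) with suc (suc a) ℕ.≟ k | suc a ℕ.≟ k
... | yes a+2≡k | _ = ⊥-elim (a+2≢k a+2≡k)
... | no  _     | yes _ = here refl
... | no  _     | no  _ = here refl
LolArc⇒∈lolNbrs _ (inj₁ close) = there (here refl)
LolArc⇒∈lolNbrs _ (inj₁ stem)  = there (there (here refl))
LolArc⇒∈lolNbrs {k} _ (inj₂ (path {a = b} b+1≢k)) with suc (suc b) ℕ.≟ k | suc b ℕ.≟ k
... | yes _ | _         = here refl
... | no  _ | yes b+1≡k = ⊥-elim (b+1≢k b+1≡k)
... | no  _ | no  _     = there (here refl)
LolArc⇒∈lolNbrs (s≤s ()) (inj₂ (close {zero}))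
LolArc⇒∈lolNbrs _ (inj₂ (close {suc a})) with suc (suc a) ℕ.≟ suc (suc a) | suc a ℕ.≟ suc (suc a)
... | yes _   | _ = there (here refl)
... | no  a≢a | _ = ⊥-elim (a≢a refl)
LolArc⇒∈lolNbrs {suc k} _ (inj₂ stem) with suc (suc k) ℕ.≟ suc k | suc k ℕ.≟ suc k
... | yes k+1≡k | _       = ⊥-elim (<-irrefl (sym k+1≡k) ≤-refl)
... | no  _     | yes _   = there (here refl)
... | no  _     | no  k≢k = ⊥-elim (k≢k refl)

lolDeg : ℕ → ℕ → ℕ
lolDeg n zero    = 3
lolDeg n (suc a) with suc (suc a) ℕ.≟ n
... | yes _ = 1
... | no  _ = 2

length-filter-<?-self : ∀ n c → length (filter (_<? n) (n ∷ c ∷ [])) ≤ 1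
length-filter-<?-self n c = subst (λ xs → length xs ≤ 1) (sym (filter-reject (_<? n) (<-irrefl refl))) (length-filter (_<? n) (c ∷ []))

length-filter-lolNbrs : ∀ {n k} a → k < n → length (filter (_<? n) (lolNbrs k a)) ≤ lolDeg n a
length-filter-lolNbrs {n} {k} zero    _   = length-filter (_<? n) (lolNbrs k zero)
length-filter-lolNbrs {n} {k} (suc a) k<n with suc (suc a) ℕ.≟ n | suc (suc a) ℕ.≟ k | suc a ℕ.≟ k
... | yes a+2≡n | yes a+2≡k | _     = ⊥-elim (<-irrefl (trans (sym a+2≡k) a+2≡n) k<n)
... | no  _     | yes _     | _     = length-filter (_<? n) (a ∷ 0 ∷ [])
... | yes refl  | no  _     | yes _ = length-filter-<?-self (suc (suc a)) 0
... | yes refl  | no  _     | no  _ = length-filter-<?-self (suc (suc a)) a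
... | no  _     | no  _     | yes _ = length-filter (_<? n) (suc (suc a) ∷ 0 ∷ [])
... | no  _     | no  _     | no  _ = length-filter (_<? n) (suc (suc a) ∷ a ∷ [])

deg-Lollipop-≤ : ∀ {n k} (3≤k : 3 ≤ k) → k < n → ∀ u → deg (Lollipop n k 3≤k) u ≤ lolDeg n (toℕ u)
deg-Lollipop-≤ {n} {k} 3≤k k<n u = begin
  deg (Lollipop n k 3≤k) u                          ≡⟨ deg≡sum (Lollipop n k 3≤k) u ⟩
  sum (indicator ∘ lolAdj n k u)                    ≤⟨ sum-indicator-≤-length (lolAdj n k u) _ nbr∈ ⟩
  length (filter (_<? n) (lolNbrs k (toℕ u)))       ≤⟨ length-filter-lolNbrs (toℕ u) k<n ⟩
  lolDeg n (toℕ u)                                  ∎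
  where
  open ≤-Reasoning
  nbr∈ : ∀ v → T (lolAdj n k u v) → toℕ v ∈ filter (_<? n) (lolNbrs k (toℕ u))
  nbr∈ v uv = ∈-filter⁺ (_<? n) (LolArc⇒∈lolNbrs 3≤k (lolAdj⇒LolArc n k u v uv)) (toℕ<n v)

sum-lolDeg³ : ∀ m → sum {suc (suc m)} (λ u → lolDeg (suc (suc m)) (toℕ u) ^ 3) ≡ 8 * suc (suc m) + 12
sum-lolDeg³ m = begin
  27 + sum {suc m} (λ i → h (suc (toℕ i)))
    ≡⟨ cong (27 +_) (sum-init-last {m} (λ i → h (suc (toℕ i)))) ⟩
  27 + (sum {m} (λ i → h (suc (toℕ (inject₁ i)))) + h (suc (toℕ (fromℕ m))))
    ≡⟨ cong₂ (λ s l → 27 + (s + h (suc l))) (trans (sum-cong-≗ inner) (sum-const m 8)) (toℕ-fromℕ m) ⟩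
  27 + (m * 8 + h (suc m))
    ≡⟨ cong (λ l → 27 + (m * 8 + l)) last≡1 ⟩
  27 + (m * 8 + 1)
    ≡⟨ solve-rearrange m ⟩
  8 * suc (suc m) + 12 ∎
  where
  open ≡-Reasoning
  h : ℕ → ℕ
  h a = lolDeg (suc (suc m)) a ^ 3
  inner : ∀ (i : Fin m) → h (suc (toℕ (inject₁ i))) ≡ 8
  inner i with suc (suc (toℕ (inject₁ i))) ℕ.≟ suc (suc m)
  ... | yes i+2≡m+2 = ⊥-elim (<-irrefl (trans (sym (toℕ-inject₁ i)) (suc-injective (suc-injective i+2≡m+2))) (toℕ<n i))
  ... | no  _       = refl
  last≡1 : h (suc m) ≡ 1
  last≡1 with suc (suc m) ℕ.≟ suc (suc m)
  ... | yes _   = refl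
  ... | no  m≢m = ⊥-elim (m≢m refl)
  solve-rearrange : ∀ m → 27 + (m * 8 + 1) ≡ 8 * suc (suc m) + 12
  solve-rearrange = solve-∀

Findex-Lollipop-≤ : ∀ {n k} (3≤k : 3 ≤ k) → k < n → Findex (Lollipop n k 3≤k) ≤ 8 * n + 12
Findex-Lollipop-≤ {suc (suc m)} {k} 3≤k k<n = begin
  Findex L                                                   ≡⟨ Findex≡sum L ⟩
  sum (λ u → deg L u ^ 3)                                    ≤⟨ sum-mono-≤ deg³≤ ⟩
  sum {suc (suc m)} (λ u → lolDeg (suc (suc m)) (toℕ u) ^ 3) ≡⟨ sum-lolDeg³ m ⟩
  8 * suc (suc m) + 12                                       ∎
  where
  open ≤-Reasoning
  L : Graph (suc (suc m))
  L = Lollipop (suc (suc m)) k 3≤k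
  deg³≤ : ∀ u → deg L u ^ 3 ≤ lolDeg (suc (suc m)) (toℕ u) ^ 3
  deg³≤ u = ^-monoˡ-≤ 3 (deg-Lollipop-≤ 3≤k k<n u)
Findex-Lollipop-≤ {0}     (s≤s (s≤s (s≤s _))) ()
Findex-Lollipop-≤ {1}     (s≤s (s≤s (s≤s _))) (s≤s ())

-- Isomorphism and the F-index

module _ {n : ℕ} (G H : Graph n) where

  deg-≅ : (iso : G ≅ H) → ∀ u → deg G u ≡ deg H (Inverse.to (proj₁ iso) u)
  deg-≅ (π , adj≡) u = begin
    deg G u                                             ≡⟨ deg≡sum G u ⟩
    sum (indicator ∘ adj G u)                           ≡⟨ sum-cong-≗ (cong indicator ∘ adj≡ u) ⟩
    sum (λ v → indicator (adj H (to u) (to v)))         ≡⟨ sum-permute (indicator ∘ adj H (to u)) π ⟨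
    sum (indicator ∘ adj H (to u))                      ≡⟨ deg≡sum H (to u) ⟨
    deg H (to u)                                        ∎
    where
    open ≡-Reasoning
    open Inverse π using (to)

  Findex-≅ : G ≅ H → Findex G ≡ Findex H
  Findex-≅ iso@(π , _) = begin
    Findex G                                   ≡⟨ Findex≡sum G ⟩
    sum (λ u → deg G u ^ 3)                    ≡⟨ sum-cong-≗ (λ u → cong (_^ 3) (deg-≅ iso u)) ⟩
    sum (λ u → deg H (Inverse.to π u) ^ 3)     ≡⟨ sum-permute (λ v → deg H v ^ 3) π ⟨
    sum (λ v → deg H v ^ 3)                    ≡⟨ Findex≡sum H ⟨
    Findex H                                   ∎
    where open ≡-Reasoning

  module _ (π : Fin n ↔ Fin n) (edge-map : ∀ {a b} → Adj H a b → Adj G (Inverse.to π a) (Inverse.to π b)) where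
    open Inverse π using (to; from; strictlyInverseˡ)

    private
      nbrs-≤ : ∀ a b → indicator (adj H a b) ≤ indicator (adj G (to a) (to b))
      nbrs-≤ a b with adj H a b in ab
      ... | false = z≤n
      ... | true  = T⇒1≤indicator (edge-map (subst T (sym ab) tt))

      deg-G∘to : ∀ a → sum (λ b → indicator (adj G (to a) (to b))) ≡ deg G (to a)
      deg-G∘to a = trans (sym (sum-permute (indicator ∘ adj G (to a)) π)) (sym (deg≡sum G (to a)))

    edge-map-deg-≤ : ∀ a → deg H a ≤ deg G (to a)
    edge-map-deg-≤ a = begin
      deg H a                                         ≡⟨ deg≡sum H a ⟩
      sum (indicator ∘ adj H a)                       ≤⟨ sum-mono-≤ (nbrs-≤ a) ⟩
      sum (λ b → indicator (adj G (to a) (to b)))     ≡⟨ deg-G∘to a ⟩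
      deg G (to a)                                    ∎
      where open ≤-Reasoning

    edge-map-adj-≡ : (∀ a → deg H a ≡ deg G (to a)) → ∀ a b → adj G (to a) (to b) ≡ adj H a b
    edge-map-adj-≡ deg-≡ a b with adj H a b in ab | adj G (to a) (to b) in ab′
    ... | true  | true  = refl
    ... | false | false = refl
    ... | true  | false with () ← subst T ab′ (edge-map (subst T (sym ab) tt))
    ... | false | true  = ⊥-elim (<-irrefl (deg-≡ a) (begin-strict
      deg H a                                         ≡⟨ deg≡sum H a ⟩
      sum (indicator ∘ adj H a)                       <⟨ m+1≤n⇒m<n (sum-mono-≤-at b (nbrs-≤ a) extra) ⟩
      sum (λ b → indicator (adj G (to a) (to b)))     ≡⟨ deg-G∘to a ⟩
      deg G (to a)                                    ∎))
      where
      open ≤-Reasoning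
      extra : indicator (adj H a b) + 1 ≤ indicator (adj G (to a) (to b))
      extra = subst₂ (λ x y → indicator x + 1 ≤ indicator y) (sym ab) (sym ab′) ≤-refl

    ≅-from-edge-map : Findex G ≤ Findex H → G ≅ H
    ≅-from-edge-map FG≤FH = ↔-sym π , λ u v →
      trans (cong₂ (adj G) (sym (strictlyInverseˡ u)) (sym (strictlyInverseˡ v))) (edge-map-adj-≡ deg-≡ (from u) (from v))
      where
      open ≤-Reasoning
      cubes-≡ : ∀ a → deg H a ^ 3 ≡ deg G (to a) ^ 3
      cubes-≡ = sum-mono-≤-≡ (λ a → ^-monoˡ-≤ 3 (edge-map-deg-≤ a)) (begin
        sum (λ a → deg G (to a) ^ 3)    ≡⟨ sum-permute (λ u → deg G u ^ 3) π ⟨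
        sum (λ u → deg G u ^ 3)         ≡⟨ Findex≡sum G ⟨
        Findex G                        ≤⟨ FG≤FH ⟩
        Findex H                        ≡⟨ Findex≡sum H ⟩
        sum (λ a → deg H a ^ 3)         ∎)
      deg-≡ : ∀ a → deg H a ≡ deg G (to a)
      deg-≡ a = ≤-antisym (edge-map-deg-≤ a) (≮⇒≥ λ lt → <-irrefl (cubes-≡ a) (^-monoˡ-< 3 lt))

-- Graphs attaining the bound

module Extremal {n} {G : Graph n} (G-conn : Connected G) {m} (S : CycleWithStick G m)
                (Findex≤ : Findex G ≤ 8 * n + 12) where
  open LowerBound G-conn S

  excess-≤-12 : sum (excess ∘ d) ≤ 12
  excess-≤-12 = +-cancelˡ-≤ (8 * n) _ _ (≤-trans 8n+excess≤Findex Findex≤)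

  over-budget : ∀ {vs} → Unique vs → 13 ≤ listSum (map (excess ∘ d) vs) → ⊥
  over-budget uniq 13≤ = <⇒≱ (≤-trans 13≤ (excess-≥-at uniq)) excess-≤-12

  leaf-exists : ∃ λ ℓ → d ℓ ≤ 1
  leaf-exists with any? (λ v → d v ≤? 1)
  ... | yes found   = found
  ... | no  no-leaf = ⊥-elim (<⇒≱ (+-monoʳ-< (8 * n) (≤ᵇ⇒≤ 13 19 tt))
                          (≤-trans (Findex-≥-no-leaf (λ v → ≰⇒> (no-leaf ∘ (v ,_)))) Findex≤))

  leaf : Fin n
  leaf = proj₁ leaf-exists

  d-leaf≤1 : d leaf ≤ 1
  d-leaf≤1 = proj₂ leaf-exists

  d-root≡3 : d root ≡ 3
  d-root≡3 with d root ≤? 3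
  ... | yes ≤3 = ≤-antisym ≤3 3≤d-root
  ... | no  ≰3 = ⊥-elim (over-budget ((root≢leaf d-leaf≤1 ∷ []) ∷ [] ∷ [])
                   (+-mono-≤ (excess-≥-8 (d root) (≰⇒> ≰3)) (+-mono-≤ (excess-≥-5 (d leaf) d-leaf≤1) z≤n)))

  d-leaf≡1 : d leaf ≡ 1
  d-leaf≡1 with d leaf in eq | d-leaf≤1
  ... | 1           | _      = refl
  ... | suc (suc _) | s≤s ()
  ... | 0           | _      = ⊥-elim (over-budget ((root≢leaf d-leaf≤1 ∷ []) ∷ [] ∷ [])
                   (+-mono-≤ (excess-≥-7 (d root) 3≤d-root)
                     (+-mono-≤ (subst (λ x → 6 ≤ excess x) (sym eq) (≤ᵇ⇒≤ 6 16 tt)) z≤n)))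

  d≡2 : ∀ {v} → v ≢ root → v ≢ leaf → d v ≡ 2
  d≡2 {v} v≢root v≢leaf with d v ℕ.≟ 2
  ... | yes dv≡2 = dv≡2
  ... | no  d≢2  = ⊥-elim (over-budget ((root≢leaf d-leaf≤1 ∷ (v≢root ∘ sym) ∷ []) ∷ ((v≢leaf ∘ sym) ∷ []) ∷ [] ∷ [])
                   (+-mono-≤ (excess-≥-7 (d root) 3≤d-root)
                     (+-mono-≤ (excess-≥-5 (d leaf) d-leaf≤1) (+-mono-≤ (excess-≥-1 (d v) d≢2) z≤n))))

  cycle-degree≥2 : ∀ i → 2 ≤ d (vtx cycle i)
  cycle-degree≥2 i = length≤deg G _ (proj₁ (cycle-neighbours cycle i)) (proj₂ (cycle-neighbours cycle i))

  cycle≢leaf : ∀ i → vtx cycle i ≢ leaf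
  cycle≢leaf i eq = <⇒≱ (cycle-degree≥2 i) (≤-reflexive (trans (cong d eq) d-leaf≡1))

  cycle-closed : ∀ {i v} → i ≢ zero → Adj G (vtx cycle i) v → CycleVertex cycle v
  cycle-closed {i} i≢0 iv with neighbours-⊆ G (vtx cycle i) (≤-reflexive (d≡2 (i≢0 ∘ inj cycle) (cycle≢leaf i)))
                                 (proj₁ (cycle-neighbours cycle i)) (proj₂ (cycle-neighbours cycle i)) iv
  ... | here  v≡next        = nextMod i , sym v≡next
  ... | there (here v≡prev) = prevMod i , sym v≡prev

  root-closed : ∀ {v} → Adj G root v → CycleVertex cycle v ⊎ v ≡ stick
  root-closed rv with neighbours-⊆ G root (≤-reflexive d-root≡3) root-neighbours-unique root-neighbours-adj rv
  ... | here  v≡next                = inj₁ (nextMod zero , sym v≡next)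
  ... | there (here v≡prev)         = inj₁ (prevMod zero , sym v≡prev)
  ... | there (there (here v≡stick)) = inj₂ v≡stick

  -- A neighbour of b other than a; b itself if there is none.
  next : Fin n → Fin n → Fin n
  next a b with any? (λ u → Bool.T? (adj G b u) ×-dec ¬? (u ≟ a))
  ... | yes (u , _) = u
  ... | no  _       = b

  next-spec : ∀ a b → 2 ≤ d b → Adj G b (next a b) × next a b ≢ a
  next-spec a b 2≤db with any? (λ u → Bool.T? (adj G b u) ×-dec ¬? (u ≟ a))
  ... | yes (_ , spec) = spec
  ... | no  none       = ⊥-elim (none (another-neighbour G b a 2≤db))

  -- trail t = (back t , pos t) follows the path root, stick, … without stepping back.
  trail : ℕ → Fin n × Fin n
  trail zero    = root , stick
  trail (suc t) = proj₂ (trail t) , next (proj₁ (trail t)) (proj₂ (trail t))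

  pos back : ℕ → Fin n
  pos  = proj₂ ∘ trail
  back = proj₁ ∘ trail

  record Simple (t : ℕ) : Set where
    field
      off-cycle : ∀ {s} → s ≤ t → ¬ CycleVertex cycle (pos s)
      injective : ∀ {s s′} → s ≤ t → s′ ≤ t → pos s ≡ pos s′ → s ≡ s′
      not-leaf  : ∀ {s} → s < t → pos s ≢ leaf
      adjacent  : ∀ {s} → s < t → Adj G (pos s) (pos (suc s))
  open Simple

  simple-0 : Simple 0
  simple-0 = record
    { off-cycle = λ { z≤n → stick-off }
    ; injective = λ { z≤n z≤n _ → refl }
    ; not-leaf  = λ ()
    ; adjacent  = λ ()
    }

  module _ {t} (P : Simple t) where

    adj-back : ∀ {s} → s ≤ t → Adj G (pos s) (back s)
    adj-back {zero}  _   = adj-sym G root-stick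
    adj-back {suc s} s<t = adj-sym G (adjacent P s<t)

    back≢forward : ∀ {s} → s < t → back s ≢ pos (suc s)
    back≢forward {zero}  0<t eq = off-cycle P 0<t (zero , eq)
    back≢forward {suc s} s<t eq with injective P (≤-trans (n≤1+n s) (<⇒≤ s<t)) s<t eq
    ... | ()

    interior-closed : ∀ {s v} → s < t → Adj G (pos s) v → v ≡ back s ⊎ v ≡ pos (suc s)
    interior-closed {s} s<t sv with neighbours-⊆ G (pos s)
        (≤-reflexive (d≡2 (off-cycle P (<⇒≤ s<t) ∘ (zero ,_) ∘ sym) (not-leaf P s<t)))
        ((back≢forward s<t ∷ []) ∷ [] ∷ []) (adj-back (<⇒≤ s<t) ∷ adjacent P s<t ∷ []) sv
    ... | here  v≡back     = inj₁ v≡back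
    ... | there (here v≡fwd) = inj₂ v≡fwd

    end-closed : ∀ {v} → pos t ≡ leaf → Adj G (pos t) v → v ≡ back t
    end-closed t≡leaf tv with neighbours-⊆ G (pos t) (≤-reflexive (trans (cong d t≡leaf) d-leaf≡1))
                                ([] ∷ []) (adj-back ≤-refl ∷ []) tv
    ... | here v≡back = v≡back

    module _ (t≢leaf : pos t ≢ leaf) where
      private
        step-spec : Adj G (pos t) (pos (suc t)) × pos (suc t) ≢ back t
        step-spec = next-spec (back t) (pos t) (≤-reflexive (sym (d≡2 (off-cycle P ≤-refl ∘ (zero ,_) ∘ sym) t≢leaf)))

        t~q : Adj G (pos t) (pos (suc t))
        t~q = proj₁ step-spec

        q≢back : pos (suc t) ≢ back t
        q≢back = proj₂ step-spec

        q~t : ∀ {u} → u ≡ pos (suc t) → Adj G u (pos t)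
        q~t u≡q = subst (λ u → Adj G u (pos t)) (sym u≡q) (adj-sym G t~q)

      step-off-cycle : ¬ CycleVertex cycle (pos (suc t))
      step-off-cycle (i , i≡q) with i ≟ zero
      ... | no  i≢0 = off-cycle P ≤-refl (cycle-closed i≢0 (q~t i≡q))
      ... | yes refl with root-closed (q~t i≡q)
      ...   | inj₁ t-on    = off-cycle P ≤-refl t-on
      ...   | inj₂ t≡stick = q≢back (trans (sym i≡q) (cong back (sym (injective P ≤-refl z≤n t≡stick))))

      step-new : ∀ {s} → s ≤ t → pos s ≢ pos (suc t)
      step-new {s} s≤t s≡q with m≤n⇒m<n∨m≡n s≤t
      ... | inj₂ refl = adj⇒≢ G t~q s≡q
      ... | inj₁ s<t with interior-closed s<t (q~t s≡q)
      ...   | inj₂ t≡s+1 = q≢back (trans (sym s≡q) (cong back (sym (injective P ≤-refl s<t t≡s+1))))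
      step-new {zero}   _ _ | inj₁ _   | inj₁ t≡root = off-cycle P ≤-refl (zero , sym t≡root)
      step-new {suc s′} _ _ | inj₁ s<t | inj₁ t≡s′ with injective P ≤-refl (≤-trans (n≤1+n s′) (<⇒≤ s<t)) t≡s′
      ... | refl = <-irrefl refl (≤-trans (n≤1+n _) s<t)

      extend : Simple (suc t)
      extend = record { off-cycle = off-cycle′ ; injective = injective′ ; not-leaf = not-leaf′ ; adjacent = adjacent′ }
        where
        off-cycle′ : ∀ {s} → s ≤ suc t → ¬ CycleVertex cycle (pos s)
        off-cycle′ s≤ with m≤1+n⇒m≤n∨m≡1+n s≤
        ... | inj₁ s≤t  = off-cycle P s≤t
        ... | inj₂ refl = step-off-cycle
        injective′ : ∀ {s s′} → s ≤ suc t → s′ ≤ suc t → pos s ≡ pos s′ → s ≡ s′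
        injective′ s≤ s′≤ eq with m≤1+n⇒m≤n∨m≡1+n s≤ | m≤1+n⇒m≤n∨m≡1+n s′≤
        ... | inj₁ s≤t  | inj₁ s′≤t = injective P s≤t s′≤t eq
        ... | inj₂ refl | inj₂ refl = refl
        ... | inj₁ s≤t  | inj₂ refl = ⊥-elim (step-new s≤t eq)
        ... | inj₂ refl | inj₁ s′≤t = ⊥-elim (step-new s′≤t (sym eq))
        not-leaf′ : ∀ {s} → s < suc t → pos s ≢ leaf
        not-leaf′ s< with m<1+n⇒m<n∨m≡n s<
        ... | inj₁ s<t  = not-leaf P s<t
        ... | inj₂ refl = t≢leaf
        adjacent′ : ∀ {s} → s < suc t → Adj G (pos s) (pos (suc s))
        adjacent′ s< with m<1+n⇒m<n∨m≡n s<
        ... | inj₁ s<t  = adjacent P s<t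
        ... | inj₂ refl = t~q

  search-leaf : ∀ t → (∃ λ s → Simple s × pos s ≡ leaf) ⊎ Simple t
  search-leaf zero    = inj₂ simple-0
  search-leaf (suc t) with search-leaf t
  ... | inj₁ found = inj₁ found
  ... | inj₂ P with pos t ≟ leaf
  ...   | yes t≡leaf = inj₁ (t , P , t≡leaf)
  ...   | no  t≢leaf = inj₂ (extend P t≢leaf)

  reaches-leaf : ∃ λ t → Simple t × pos t ≡ leaf
  reaches-leaf with search-leaf n
  ... | inj₁ found = found
  ... | inj₂ P     = ⊥-elim (<-irrefl refl (injective⇒≤ {f = pos ∘ toℕ {suc n}}
                      λ {i} {j} eq → toℕ-injective (injective P (≤-pred (toℕ<n i)) (≤-pred (toℕ<n j)) eq)))

  tail : ℕ
  tail = proj₁ reaches-leaf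

  trail-simple : Simple tail
  trail-simple = proj₁ (proj₂ reaches-leaf)

  trail-ends-at-leaf : pos tail ≡ leaf
  trail-ends-at-leaf = proj₂ (proj₂ reaches-leaf)

  Reached : Fin n → Set
  Reached u = CycleVertex cycle u ⊎ ∃ λ s → s ≤ tail × pos s ≡ u

  back-reached : ∀ {s} → s ≤ tail → Reached (back s)
  back-reached {zero}  _ = inj₁ (zero , refl)
  back-reached {suc s} s<tail = inj₂ (s , <⇒≤ s<tail , refl)

  reached-closed : ∀ {v u} → Adj G v u → Reached u → Reached v
  reached-closed {v} vu (inj₁ (i , i≡u)) with i ≟ zero
  ... | no  i≢0 = inj₁ (cycle-closed i≢0 (subst (λ w → Adj G w v) (sym i≡u) (adj-sym G vu)))
  ... | yes refl with root-closed (subst (λ w → Adj G w v) (sym i≡u) (adj-sym G vu))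
  ...   | inj₁ v-on    = inj₁ v-on
  ...   | inj₂ v≡stick = inj₂ (0 , z≤n , sym v≡stick)
  reached-closed {v} vu (inj₂ (s , s≤tail , s≡u)) with m≤n⇒m<n∨m≡n s≤tail
  ... | inj₁ s<tail with interior-closed trail-simple s<tail (subst (λ w → Adj G w v) (sym s≡u) (adj-sym G vu))
  ...   | inj₁ v≡back = subst Reached (sym v≡back) (back-reached (<⇒≤ s<tail))
  ...   | inj₂ v≡fwd  = inj₂ (suc s , s<tail , sym v≡fwd)
  reached-closed {v} vu (inj₂ (s , s≤tail , s≡u)) | inj₂ refl =
    subst Reached (sym (end-closed trail-simple trail-ends-at-leaf (subst (λ w → Adj G w v) (sym s≡u) (adj-sym G vu))))
          (back-reached ≤-refl)

  all-reached : ∀ u → Reached u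
  all-reached u = walk-closed G Reached reached-closed (G-conn u root) (inj₁ (zero , refl))

  K : ℕ
  K = suc m

  -- Vertex a < k of L_{n,k} is the a-th vertex of the cycle, vertex k + s the s-th vertex of the trail.
  label : ℕ → Fin n
  label a with a <? K
  ... | yes a<K = vtx cycle (fromℕ< a<K)
  ... | no  _   = pos (a ∸ K)

  label-< : ∀ {a} (a<K : a < K) → label a ≡ vtx cycle (fromℕ< a<K)
  label-< {a} a<K with a <? K
  ... | yes _   = cong (vtx cycle) (Fin.fromℕ<-cong a a refl _ _)
  ... | no  a≮K = ⊥-elim (a≮K a<K)

  label-≥ : ∀ {a} → K ≤ a → label a ≡ pos (a ∸ K)
  label-≥ {a} K≤a with a <? K
  ... | yes a<K = ⊥-elim (<⇒≱ a<K K≤a)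
  ... | no  _   = refl

  N : ℕ
  N = K + suc tail

  ∸K≤tail : ∀ {b} → K ≤ b → b < N → b ∸ K ≤ tail
  ∸K≤tail {b} K≤b b<N = ≤-pred (+-cancelˡ-< K (b ∸ K) (suc tail) (subst (_< N) (sym (m+[n∸m]≡n K≤b)) b<N))

  label-injective : ∀ {a b} → a < N → b < N → label a ≡ label b → a ≡ b
  label-injective {a} {b} a<N b<N eq with <-≤-connex a K | <-≤-connex b K
  ... | inj₁ a<K | inj₁ b<K = trans (sym (toℕ-fromℕ< a<K))
      (trans (cong toℕ (inj cycle (trans (sym (label-< a<K)) (trans eq (label-< b<K))))) (toℕ-fromℕ< b<K))
  ... | inj₁ a<K | inj₂ K≤b = ⊥-elim (off-cycle trail-simple (∸K≤tail K≤b b<N)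
      (fromℕ< a<K , trans (sym (label-< a<K)) (trans eq (label-≥ K≤b))))
  ... | inj₂ K≤a | inj₁ b<K = ⊥-elim (off-cycle trail-simple (∸K≤tail K≤a a<N)
      (fromℕ< b<K , trans (sym (label-< b<K)) (trans (sym eq) (label-≥ K≤a))))
  ... | inj₂ K≤a | inj₂ K≤b = trans (sym (m+[n∸m]≡n K≤a)) (trans (cong (K +_) a∸K≡b∸K) (m+[n∸m]≡n K≤b))
    where
    a∸K≡b∸K : a ∸ K ≡ b ∸ K
    a∸K≡b∸K = injective trail-simple (∸K≤tail K≤a a<N) (∸K≤tail K≤b b<N)
                (trans (sym (label-≥ K≤a)) (trans eq (label-≥ K≤b)))

  label-surjective : ∀ u → ∃ λ a → a < N × label a ≡ u
  label-surjective u with all-reached u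
  ... | inj₁ (i , i≡u) = toℕ i , ≤-trans (toℕ<n i) (m≤m+n K (suc tail)) ,
                         trans (label-< (toℕ<n i)) (trans (cong (vtx cycle) (fromℕ<-toℕ i (toℕ<n i))) i≡u)
  ... | inj₂ (s , s≤tail , s≡u) = K + s , +-monoʳ-< K (s≤s s≤tail) ,
                         trans (label-≥ (m≤m+n K s)) (trans (cong pos (m+n∸m≡n K s)) s≡u)

  N≡n : N ≡ n
  N≡n = ≤-antisym (injective⇒≤ {f = label ∘ toℕ {N}} (λ {a} {b} eq → toℕ-injective (label-injective (toℕ<n a) (toℕ<n b) eq)))
                  (injective⇒≤ {f = index} index-injective)
    where
    index : Fin n → Fin N
    index u = fromℕ< (proj₁ (proj₂ (label-surjective u)))
    index-injective : Injective _≡_ _≡_ index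
    index-injective {u} {v} eq = begin
      u                                       ≡⟨ proj₂ (proj₂ (label-surjective u)) ⟨
      label (proj₁ (label-surjective u))      ≡⟨ cong label (trans (sym (toℕ-fromℕ< _)) (trans (cong toℕ eq) (toℕ-fromℕ< _))) ⟩
      label (proj₁ (label-surjective v))      ≡⟨ proj₂ (proj₂ (label-surjective v)) ⟩
      v                                       ∎
      where open ≡-Reasoning

  toℕ<N : ∀ (a : Fin n) → toℕ a < N
  toℕ<N a = subst (toℕ a <_) (sym N≡n) (toℕ<n a)

  relabel : Fin n ↔ Fin n
  relabel = mk↔ₛ′ to from to-from from-to
    where
    index<n : ∀ u → proj₁ (label-surjective u) < n
    index<n u = subst (proj₁ (label-surjective u) <_) N≡n (proj₁ (proj₂ (label-surjective u)))
    to from : Fin n → Fin n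
    to a   = label (toℕ a)
    from u = fromℕ< (index<n u)
    to-from : ∀ u → to (from u) ≡ u
    to-from u = trans (cong label (toℕ-fromℕ< (index<n u))) (proj₂ (proj₂ (label-surjective u)))
    from-to : ∀ a → from (to a) ≡ a
    from-to a = toℕ-injective (label-injective (toℕ<N (from (to a))) (toℕ<N a) (to-from (to a)))

  arc-edge : ∀ {a b} → LolArc K a b → b < N → Adj G (label a) (label b)
  arc-edge {a} (path a+1≢K) a+1<N with <-≤-connex (suc a) K
  ... | inj₁ a+1<K = subst₂ (Adj G) (sym (label-< a<K)) (sym (label-< a+1<K))
                       (subst (λ i → Adj G (vtx cycle (fromℕ< a<K)) (vtx cycle i)) (sym next≡) (edges cycle (fromℕ< a<K)))
    where
    a<K : a < K
    a<K = <-trans (n<1+n a) a+1<K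
    next≡ : fromℕ< a+1<K ≡ nextMod (fromℕ< a<K)
    next≡ = toℕ-injective (trans (toℕ-fromℕ< a+1<K)
              (sym (trans (toℕ-nextMod (fromℕ< a<K) (subst (_< m) (sym (toℕ-fromℕ< a<K)) (≤-pred a+1<K))) (cong suc (toℕ-fromℕ< a<K)))))
  ... | inj₂ K≤a+1 = subst₂ (Adj G) (sym (label-≥ K≤a)) (sym (label-≥ K≤a+1))
                       (subst (λ s → Adj G (pos (a ∸ K)) (pos s)) (sym a+1∸K)
                         (adjacent trail-simple (subst (_≤ tail) a+1∸K (∸K≤tail K≤a+1 a+1<N))))
    where
    K≤a : K ≤ a
    K≤a = ≤-pred (≤∧≢⇒< K≤a+1 (a+1≢K ∘ sym))
    a+1∸K : suc a ∸ K ≡ suc (a ∸ K)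
    a+1∸K = +-∸-assoc 1 K≤a
  arc-edge close _ = adj-sym G (subst₂ (Adj G) (sym (label-< (n<1+n m))) refl
                       (subst (λ i → Adj G (vtx cycle (fromℕ< (n<1+n m))) (vtx cycle i))
                              (nextMod-last (fromℕ< (n<1+n m)) (toℕ-fromℕ< (n<1+n m))) (edges cycle (fromℕ< (n<1+n m)))))
  arc-edge stem _ = subst (Adj G root) (sym (trans (label-≥ ≤-refl) (cong pos (n∸n≡0 K)))) root-stick

  relabel-edge : ∀ {a b} → T (lolAdj n K a b) → Adj G (Inverse.to relabel a) (Inverse.to relabel b)
  relabel-edge {a} {b} ab with lolAdj⇒LolArc n K a b ab
  ... | inj₁ arc = arc-edge arc (toℕ<N b)
  ... | inj₂ arc = adj-sym G (arc-edge arc (toℕ<N a))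

theorem15 : (n k : ℕ) (h3 : 3 ≤ k) → k < n → (G : Graph n) → Unicyclic G → Cycle G k →
    (Findex G ≥ Findex (Lollipop n k h3))
      × ((Findex G ≡ Findex (Lollipop n k h3)) ⇔ (G ≅ Lollipop n k h3))
theorem15 n (suc m) 3≤k k<n G (G-conn , _ , _) C =
  ≤-trans Findex-L≤8n+12 (LowerBound.Findex-≥ G-conn S) , mk⇔ extremal (Findex-≅ G L)
  where
  S : CycleWithStick G m
  S = cycle-with-stick G-conn C k<n
  L : Graph n
  L = Lollipop n (suc m) 3≤k
  Findex-L≤8n+12 : Findex L ≤ 8 * n + 12
  Findex-L≤8n+12 = Findex-Lollipop-≤ 3≤k k<n
  extremal : Findex G ≡ Findex L → G ≅ L
  extremal F≡ = ≅-from-edge-map G L relabel (λ {a} {b} → relabel-edge {a} {b}) (≤-reflexive F≡)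
    where open Extremal G-conn S (≤-trans (≤-reflexive F≡) Findex-L≤8n+12)
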